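{- Let $G$ be a connected regular graph. If $G$ is not complete, then $G$ is active, i.e. every vertex of $G$ is active.
   Context: All graphs are finite and simple. A vertex $v$ of $G$ is active in $G$ if there is a set $W$ of four vertices containing $v$ such that the induced subgraph $\langle W\rangle_G$ is isomorphic to $P_4$, $C_4$ or $2K_2$. A graph is active if all its vertices are active. -}

module Defs where

open import Level using (0ℓ)
open import Data.Nat using (ℕ; suc)
open import Data.Fin using (Fin; zero; suc)
open import Data.List using (List; length; filter; allFin)
open import Data.Product using (Σ; ∃; ∃-syntax; _×_; _,_)
open import Data.Sum using (_⊎_)
open import Relation.Nullary using (¬_; Dec)
open import Relation.Binary.PropositionalEquality using (_≡_; _≢_)
open import Relation.Binary using (Decidable)
open import Relation.Binary.Construct.Closure.ReflexiveTransitive using (Star)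
open import Function.Definitions using (Injective)
open import Function.Bundles using (_⇔_)

record Graph (n : ℕ) : Set₁ where
  field
    Adj     : Fin n → Fin n → Set
    adj?    : Decidable Adj
    sym     : ∀ {u v} → Adj u v → Adj v u
    irrefl  : ∀ {v} → ¬ Adj v v

open Graph public

degree : ∀ {n} (G : Graph n) → Fin n → ℕ
degree G v = length (filter (adj? G v) (allFin _))

Regular : ∀ {n} → Graph n → Set
Regular G = ∃[ k ] (∀ v → degree G v ≡ k)

Connected : ∀ {n} → Graph n → Set
Connected G = ∀ u v → Star (Adj G) u v

Complete : ∀ {n} → Graph n → Set
Complete G = ∀ u v → u ≢ v → Adj G u v

-- The three 4-vertex graphs P4, C4, 2K2 on vertex set Fin 4 = {0,1,2,3}
-- given by their (oriented) edge lists; adjacency is the symmetric closure.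
𝟘 𝟙 𝟚 𝟛 : Fin 4
𝟘 = zero
𝟙 = suc zero
𝟚 = suc (suc zero)
𝟛 = suc (suc (suc zero))

data P4-edge : Fin 4 → Fin 4 → Set where
  e01 : P4-edge 𝟘 𝟙
  e12 : P4-edge 𝟙 𝟚
  e23 : P4-edge 𝟚 𝟛

data C4-edge : Fin 4 → Fin 4 → Set where
  e01 : C4-edge 𝟘 𝟙
  e12 : C4-edge 𝟙 𝟚
  e23 : C4-edge 𝟚 𝟛
  e30 : C4-edge 𝟛 𝟘

data 2K2-edge : Fin 4 → Fin 4 → Set where
  e01 : 2K2-edge 𝟘 𝟙
  e23 : 2K2-edge 𝟚 𝟛

SymClosure : (Fin 4 → Fin 4 → Set) → Fin 4 → Fin 4 → Set
SymClosure R i j = R i j ⊎ R j i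

-- ⟨W⟩_G ≅ H, where W is the image of an injective map f : Fin 4 → Fin n
-- (so |W| = 4) and f is a graph isomorphism from H onto the induced subgraph.
InducedIso : ∀ {n} (G : Graph n) (H : Fin 4 → Fin 4 → Set) (f : Fin 4 → Fin n) → Set
InducedIso G H f = Injective _≡_ _≡_ f × (∀ i j → Adj G (f i) (f j) ⇔ H i j)

Active : ∀ {n} (G : Graph n) → Fin n → Set
Active {n} G v = ∃[ f ] (∃[ i ] f i ≡ v) ×
  (InducedIso G (SymClosure P4-edge) f
   ⊎ InducedIso G (SymClosure C4-edge) f
   ⊎ InducedIso G (SymClosure 2K2-edge) f)

ActiveGraph : ∀ {n} → Graph n → Set
ActiveGraph G = ∀ v → Active G v

-- Fix v and pick a vertex y at distance two from v, through a middle vertex x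
-- (it exists since G is connected and, being regular and not complete, has no
-- dominating vertex). If v has a neighbour a not adjacent to y, then equal
-- degrees give a neighbour b of y not adjacent to v, and v, a, b, y induce P4
-- or 2K2 according as a ~ b. Otherwise N(v) ⊆ N(y); if moreover N[v] ⊆ N[x],
-- equal degrees force N[x] = N[v], which is absurd as y ∈ N[x]; so some
-- neighbour q of v misses N[x], and v, x, y, q induce C4.
module Submission where

open import Level using (Level)
open import Data.Nat using (ℕ; zero; suc; _≤_; _<_; z≤n; s≤s)
open import Data.Nat.Properties using (≤-antisym; m≤n⇒m≤1+n; <⇒≢)
open import Data.Fin using (Fin; zero; suc; _≟_)
open import Data.Fin.Patterns using (0F; 1F; 2F; 3F)
open import Data.Fin.Properties using (any?; suc-injective)
open import Data.List using (length; filter; tabulate)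
open import Data.Vec using (_∷_; []; lookup)
open import Data.Product using (∃-syntax; ∃₂; _×_; _,_; proj₁; proj₂)
open import Data.Unit using (tt)
open import Data.Sum using (_⊎_; inj₁; inj₂; [_,_]; swap)
open import Function using (_∘_; id)
open import Function.Bundles using (_⇔_; mk⇔; Equivalence)
open import Relation.Nullary using (¬_; yes; no; contradiction)
open import Relation.Nullary.Decidable using (decidable-stable; toSum)
open import Relation.Unary using (Pred; Decidable; _⊆_; _≐_; _∉_; ｛_｝; _∪_)
open import Relation.Unary.Properties using (_∪?_; _∩?_; ∁?; U?)
open import Relation.Binary.Core using (Rel)
open import Relation.Binary.Definitions using (Reflexive; Symmetric)
open import Relation.Binary.PropositionalEquality
  using (_≡_; _≢_; refl; cong; module ≡-Reasoning) renaming (sym to ≡-sym)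
open import Relation.Binary.Construct.Closure.ReflexiveTransitive using (Star; ε; _◅_)

open import Defs

private
  variable
    a p q r : Level
    A : Set a
    n : ℕ

count : {P : Pred (Fin n) p} → Decidable P → ℕ
count {n = zero}  P? = 0
count {n = suc n} P? with P? zero
... | yes _ = suc (count (P? ∘ suc))
... | no  _ = count (P? ∘ suc)

length-filter-tabulate : {P : Pred A p} (P? : Decidable P) (f : Fin n → A) →
                         length (filter P? (tabulate f)) ≡ count (P? ∘ f)
length-filter-tabulate {n = zero}  P? f = refl
length-filter-tabulate {n = suc n} P? f with P? (f zero)
... | yes _ = cong suc (length-filter-tabulate P? (f ∘ suc))
... | no  _ = length-filter-tabulate P? (f ∘ suc)

count-mono : {P : Pred (Fin n) p} {Q : Pred (Fin n) q} →
  (P? : Decidable P) (Q? : Decidable Q) →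
  P ⊆ Q → count P? ≤ count Q?
count-mono {n = zero}  P? Q? P⊆Q = z≤n
count-mono {n = suc n} P? Q? P⊆Q with P? zero | Q? zero
... | yes _  | yes _  = s≤s (count-mono (P? ∘ suc) (Q? ∘ suc) P⊆Q)
... | yes p₀ | no ¬q₀ = contradiction (P⊆Q p₀) ¬q₀
... | no _   | yes _  = m≤n⇒m≤1+n (count-mono (P? ∘ suc) (Q? ∘ suc) P⊆Q)
... | no _   | no _   = count-mono (P? ∘ suc) (Q? ∘ suc) P⊆Q

count-strict : {P : Pred (Fin n) p} {Q : Pred (Fin n) q} →
  (P? : Decidable P) (Q? : Decidable Q) →
  P ⊆ Q → ∀ {x} → Q x → x ∉ P → count P? < count Q?
count-strict P? Q? P⊆Q {zero} Qx ¬Px with P? zero | Q? zero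
... | yes p₀ | _      = contradiction p₀ ¬Px
... | no _   | no ¬q₀ = contradiction Qx ¬q₀
... | no _   | yes _  = s≤s (count-mono (P? ∘ suc) (Q? ∘ suc) P⊆Q)
count-strict P? Q? P⊆Q {suc x} Qx ¬Px with P? zero | Q? zero
... | yes _  | yes _  = s≤s (count-strict (P? ∘ suc) (Q? ∘ suc) P⊆Q Qx ¬Px)
... | yes p₀ | no ¬q₀ = contradiction (P⊆Q p₀) ¬q₀
... | no _   | yes _  = m≤n⇒m≤1+n (count-strict (P? ∘ suc) (Q? ∘ suc) P⊆Q Qx ¬Px)
... | no _   | no _   = count-strict (P? ∘ suc) (Q? ∘ suc) P⊆Q Qx ¬Px

count-cong : {P : Pred (Fin n) p} {Q : Pred (Fin n) q} →
  (P? : Decidable P) (Q? : Decidable Q) →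
  P ≐ Q → count P? ≡ count Q?
count-cong P? Q? (P⊆Q , Q⊆P) = ≤-antisym (count-mono P? Q? P⊆Q) (count-mono Q? P? Q⊆P)

count-insert : {P : Pred (Fin n) p} {Q : Pred (Fin n) q} →
  (P? : Decidable P) (Q? : Decidable Q) →
  P ⊆ Q → ∀ {x} → Q x → x ∉ P → (∀ {u} → Q u → u ≢ x → P u) →
  count Q? ≡ suc (count P?)
count-insert P? Q? P⊆Q {zero} Qx ¬Px Q⊆P∪x with P? zero | Q? zero
... | yes p₀ | _      = contradiction p₀ ¬Px
... | no _   | no ¬q₀ = contradiction Qx ¬q₀
... | no _   | yes _  =
  cong suc (count-cong (Q? ∘ suc) (P? ∘ suc) ((λ Qu → Q⊆P∪x Qu λ ()) , P⊆Q))
count-insert P? Q? P⊆Q {suc x} Qx ¬Px Q⊆P∪x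
  with tail ← count-insert (P? ∘ suc) (Q? ∘ suc) P⊆Q Qx ¬Px
                 (λ Qu u≢x → Q⊆P∪x Qu (u≢x ∘ suc-injective))
     | P? zero | Q? zero
... | yes _  | yes _  = cong suc tail
... | no _   | no _   = tail
... | yes p₀ | no ¬q₀ = contradiction (P⊆Q p₀) ¬q₀
... | no ¬p₀ | yes q₀ = contradiction (Q⊆P∪x q₀ λ ()) ¬p₀

⊆-or-counterexample : {P : Pred (Fin n) p} {Q : Pred (Fin n) q} →
                      Decidable P → Decidable Q → P ⊆ Q ⊎ ∃[ x ] P x × x ∉ Q
⊆-or-counterexample P? Q? with any? (P? ∩? ∁? Q?)
... | yes counterexample = inj₂ counterexample
... | no  none           =
  inj₁ λ {x} Px → decidable-stable (Q? x) (λ ¬Qx → none (x , Px , ¬Qx))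

⊆∧count≡⇒⊇ : {P : Pred (Fin n) p} {Q : Pred (Fin n) q} →
  (P? : Decidable P) (Q? : Decidable Q) →
  P ⊆ Q → count P? ≡ count Q? → Q ⊆ P
⊆∧count≡⇒⊇ P? Q? P⊆Q eq {x} Qx =
  decidable-stable (P? x) (λ ¬Px → <⇒≢ (count-strict P? Q? P⊆Q Qx ¬Px) eq)

count≡⇒exchange : {P : Pred (Fin n) p} {Q : Pred (Fin n) q} →
  (P? : Decidable P) (Q? : Decidable Q) →
  count P? ≡ count Q? → ∀ {x} → P x → x ∉ Q → ∃[ y ] Q y × y ∉ P
count≡⇒exchange P? Q? eq Px ¬Qx with ⊆-or-counterexample Q? P?
... | inj₁ Q⊆P           = contradiction (⊆∧count≡⇒⊇ Q? P? Q⊆P (≡-sym eq) Px) ¬Qx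
... | inj₂ counterexample = counterexample

exit-edge : {R : Rel A r} {S : Pred A p} → Decidable S →
            ∀ {x y} → Star R x y → S x → y ∉ S → ∃₂ λ u w → S u × R u w × w ∉ S
exit-edge S? ε           Sx ¬Sy = contradiction Sx ¬Sy
exit-edge S? (xRz ◅ z*y) Sx ¬Sy with S? _
... | yes Sz = exit-edge S? z*y Sz ¬Sy
... | no ¬Sz = _ , _ , Sx , xRz , ¬Sz

OnPairs : Rel (Fin 4) r → Set r
OnPairs R = R 𝟘 𝟙 × R 𝟘 𝟚 × R 𝟘 𝟛 × R 𝟙 𝟚 × R 𝟙 𝟛 × R 𝟚 𝟛

OnPairs-map : {R : Rel (Fin 4) r} {S : Rel (Fin 4) q} →
              (∀ {i j} → R i j → S i j) → OnPairs R → OnPairs S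
OnPairs-map f (r01 , r02 , r03 , r12 , r13 , r23) =
  f r01 , f r02 , f r03 , f r12 , f r13 , f r23

OnPairs⇒all : {R : Rel (Fin 4) r} → Reflexive R → Symmetric R → OnPairs R → ∀ i j → R i j
OnPairs⇒all {R = R} ρ σ (r01 , r02 , r03 , r12 , r13 , r23) = all
  where
  all : ∀ i j → R i j
  all 0F 0F = ρ
  all 0F 1F = r01
  all 0F 2F = r02
  all 0F 3F = r03
  all 1F 0F = σ r01
  all 1F 1F = ρ
  all 1F 2F = r12
  all 1F 3F = r13
  all 2F 0F = σ r02
  all 2F 1F = σ r12
  all 2F 2F = ρ
  all 2F 3F = r23
  all 3F 0F = σ r03
  all 3F 1F = σ r13
  all 3F 2F = σ r23
  all 3F 3F = ρ

quad : Fin n → Fin n → Fin n → Fin n → Fin 4 → Fin n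
quad a b c d = lookup (a ∷ b ∷ c ∷ d ∷ [])

module _ (G : Graph n) where
  private
    infix 4 _~_
    _~_ : Fin n → Fin n → Set
    _~_ = Adj G

  N[_] : Fin n → Pred (Fin n) _
  N[ v ] = ｛ v ｝ ∪ Adj G v

  N[_]? : ∀ v → Decidable N[ v ]
  N[ v ]? = (v ≟_) ∪? adj? G v

  ~⇒≢ : ∀ {u w} → u ~ w → u ≢ w
  ~⇒≢ uw refl = irrefl G uw

  module InducedBy (E : Fin 4 → Fin 4 → Set) where
    edge : ∀ {u w i j} → u ~ w → SymClosure E i j → (u ~ w ⇔ SymClosure E i j)
    edge uw e = mk⇔ (λ _ → e) (λ _ → uw)

    non-edge : ∀ {u w i j} → ¬ u ~ w → ¬ E i j → ¬ E j i →
               (u ~ w ⇔ SymClosure E i j)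
    non-edge ¬uw ¬Eij ¬Eji =
      mk⇔ (λ uw → contradiction uw ¬uw) (λ e → contradiction e [ ¬Eij , ¬Eji ])

    induced-by-pairs : ∀ (f : Fin 4 → Fin n) → (∀ {i} → ¬ E i i) →
                       OnPairs (λ i j → f i ≢ f j) →
                       OnPairs (λ i j → f i ~ f j ⇔ SymClosure E i j) →
                       InducedIso G (SymClosure E) f
    induced-by-pairs f irreflexive distinct adjacency =
      (λ {i} {j} → injective i j) , OnPairs⇒all iff-refl iff-sym adjacency
      where
      Reflected : Rel (Fin 4) _
      Reflected i j = f i ≡ f j → i ≡ j
      injective : ∀ i j → Reflected i j
      injective = OnPairs⇒all {R = Reflected} (λ _ → refl) (λ h → ≡-sym ∘ h ∘ ≡-sym)
        (OnPairs-map {S = Reflected} (λ fi≢fj fi≡fj → contradiction fi≡fj fi≢fj) distinct)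
      iff-refl : ∀ {i} → f i ~ f i ⇔ SymClosure E i i
      iff-refl = non-edge (irrefl G) irreflexive irreflexive
      iff-sym : ∀ {i j} → (f i ~ f j ⇔ SymClosure E i j) →
                (f j ~ f i ⇔ SymClosure E j i)
      iff-sym h = mk⇔ (swap ∘ Equivalence.to h ∘ sym G) (sym G ∘ Equivalence.from h ∘ swap)

  P4-induced : ∀ {a b c d} → a ~ b → b ~ c → c ~ d → ¬ a ~ c → ¬ b ~ d → ¬ a ~ d →
               a ≢ c → b ≢ d → a ≢ d → InducedIso G (SymClosure P4-edge) (quad a b c d)
  P4-induced ab bc cd ¬ac ¬bd ¬ad a≢c b≢d a≢d = induced-by-pairs _ (λ ())
    (~⇒≢ ab , a≢c , a≢d , ~⇒≢ bc , b≢d , ~⇒≢ cd)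
    ( edge ab (inj₁ e01) , non-edge ¬ac (λ ()) (λ ()) , non-edge ¬ad (λ ()) (λ ())
    , edge bc (inj₁ e12) , non-edge ¬bd (λ ()) (λ ()) , edge cd (inj₁ e23))
    where open InducedBy P4-edge

  C4-induced : ∀ {a b c d} → a ~ b → b ~ c → c ~ d → d ~ a → ¬ a ~ c → ¬ b ~ d →
               a ≢ c → b ≢ d → InducedIso G (SymClosure C4-edge) (quad a b c d)
  C4-induced ab bc cd da ¬ac ¬bd a≢c b≢d = induced-by-pairs _ (λ ())
    (~⇒≢ ab , a≢c , ~⇒≢ (sym G da) , ~⇒≢ bc , b≢d , ~⇒≢ cd)
    ( edge ab (inj₁ e01) , non-edge ¬ac (λ ()) (λ ()) , edge (sym G da) (inj₂ e30)
    , edge bc (inj₁ e12) , non-edge ¬bd (λ ()) (λ ()) , edge cd (inj₁ e23))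
    where open InducedBy C4-edge

  2K2-induced : ∀ {a b c d} → a ~ b → c ~ d → ¬ a ~ c → ¬ a ~ d → ¬ b ~ c → ¬ b ~ d →
                a ≢ c → a ≢ d → b ≢ c → b ≢ d →
                InducedIso G (SymClosure 2K2-edge) (quad a b c d)
  2K2-induced ab cd ¬ac ¬ad ¬bc ¬bd a≢c a≢d b≢c b≢d = induced-by-pairs _ (λ ())
    (~⇒≢ ab , a≢c , a≢d , b≢c , b≢d , ~⇒≢ cd)
    ( edge ab (inj₁ e01) , non-edge ¬ac (λ ()) (λ ()) , non-edge ¬ad (λ ()) (λ ())
    , non-edge ¬bc (λ ()) (λ ()) , non-edge ¬bd (λ ()) (λ ()) , edge cd (inj₁ e23))
    where open InducedBy 2K2-edge

  count-N[] : ∀ v → count N[ v ]? ≡ suc (count (adj? G v))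
  count-N[] v = count-insert (adj? G v) N[ v ]? inj₂ (inj₁ refl) (irrefl G) λ where
    (inj₁ refl) u≢v → contradiction refl u≢v
    (inj₂ vu)   _   → vu

  degree≡count : ∀ v → degree G v ≡ count (adj? G v)
  degree≡count v = length-filter-tabulate (adj? G v) id

  module _ (regular : Regular G) where
    count-adj-regular : ∀ u w → count (adj? G u) ≡ count (adj? G w)
    count-adj-regular u w = begin
      count (adj? G u) ≡⟨ ≡-sym (degree≡count u) ⟩
      degree G u       ≡⟨ proj₂ regular u ⟩
      proj₁ regular    ≡⟨ ≡-sym (proj₂ regular w) ⟩
      degree G w       ≡⟨ degree≡count w ⟩
      count (adj? G w) ∎
      where open ≡-Reasoning

    N[]-⊆⇒⊇ : ∀ {u w} → N[ u ] ⊆ N[ w ] → N[ w ] ⊆ N[ u ]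
    N[]-⊆⇒⊇ {u} {w} N[u]⊆N[w] = ⊆∧count≡⇒⊇ N[ u ]? N[ w ]? N[u]⊆N[w] (begin
      count N[ u ]?          ≡⟨ count-N[] u ⟩
      suc (count (adj? G u)) ≡⟨ cong suc (count-adj-regular u w) ⟩
      suc (count (adj? G w)) ≡⟨ ≡-sym (count-N[] w) ⟩
      count N[ w ]?          ∎)
      where open ≡-Reasoning

    active-of-private-neighbour : ∀ {v y a} → y ∉ N[ v ] → v ~ a → ¬ y ~ a → Active G v
    active-of-private-neighbour {v} {y} {a} y∉N[v] va ¬ya
      with b , yb , ¬vb ←
             count≡⇒exchange (adj? G v) (adj? G y) (count-adj-regular v y) va ¬ya
      = [ via-P4 , via-2K2 ] (toSum (adj? G a b))
      where
      ¬vy : ¬ v ~ y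
      ¬vy = y∉N[v] ∘ inj₂
      v≢y : v ≢ y
      v≢y = y∉N[v] ∘ inj₁
      v≢b : v ≢ b
      v≢b refl = ¬vy (sym G yb)
      a≢y : a ≢ y
      a≢y refl = ¬vy va
      a≢b : a ≢ b
      a≢b refl = ¬vb va
      via-P4 : a ~ b → Active G v
      via-P4 ab = quad v a b y , (𝟘 , refl) ,
        inj₁ (P4-induced va ab (sym G yb) ¬vb (¬ya ∘ sym G) ¬vy v≢b a≢y v≢y)
      via-2K2 : ¬ a ~ b → Active G v
      via-2K2 ¬ab = quad v a y b , (𝟘 , refl) ,
        inj₂ (inj₂ (2K2-induced va yb ¬vy ¬vb (¬ya ∘ sym G) ¬ab v≢y v≢b a≢y a≢b))

    active-of-neighbourhood-⊆ : ∀ {v x y} → v ~ x → x ~ y → y ∉ N[ v ] →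
                                Adj G v ⊆ Adj G y → Active G v
    active-of-neighbourhood-⊆ {v} {x} {y} vx xy y∉N[v] N⊆N
      with ⊆-or-counterexample N[ v ]? N[ x ]?
    ... | inj₁ N[v]⊆N[x]                = contradiction (N[]-⊆⇒⊇ N[v]⊆N[x] (inj₂ xy)) y∉N[v]
    ... | inj₂ (_ , inj₁ refl , v∉N[x]) = contradiction (inj₂ (sym G vx)) v∉N[x]
    ... | inj₂ (q , inj₂ vq , q∉N[x])   = quad v x y q , (𝟘 , refl) ,
      inj₂ (inj₁ (C4-induced vx xy (N⊆N vq) (sym G vq) (y∉N[v] ∘ inj₂) (q∉N[x] ∘ inj₂)
                             (y∉N[v] ∘ inj₁) (q∉N[x] ∘ inj₁)))

    active-at-distance-two : ∀ {v x y} → v ~ x → x ~ y → y ∉ N[ v ] → Active G v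
    active-at-distance-two vx xy y∉N[v] with ⊆-or-counterexample (adj? G _) (adj? G _)
    ... | inj₁ N⊆N            = active-of-neighbourhood-⊆ vx xy y∉N[v] N⊆N
    ... | inj₂ (_ , va , ¬ya) = active-of-private-neighbour y∉N[v] va ¬ya

    module _ (connected : Connected G) (¬complete : ¬ Complete G) where
      non-neighbour : ∀ v → ∃[ u ] u ∉ N[ v ]
      non-neighbour v with ⊆-or-counterexample U? N[ v ]?
      ... | inj₂ (u , _ , u∉N[v]) = u , u∉N[v]
      ... | inj₁ U⊆N[v]           = contradiction complete ¬complete
        where
        complete : Complete G
        complete w w′ w≢w′ = [ (λ w≡w′ → contradiction w≡w′ w≢w′) , id ]
                               (N[]-⊆⇒⊇ (λ _ → U⊆N[v] tt) (U⊆N[v] tt))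

      distance-two : ∀ v → ∃₂ λ x y → v ~ x × x ~ y × y ∉ N[ v ]
      distance-two v with u , u∉N[v] ← non-neighbour v
                     with exit-edge N[ v ]? (connected v u) (inj₁ refl) u∉N[v]
      ... | _ , y , inj₁ refl , vy , y∉N[v] = contradiction (inj₂ vy) y∉N[v]
      ... | x , y , inj₂ vx , xy , y∉N[v]   = x , y , vx , xy , y∉N[v]

mainTheorem4 : ∀ {n : ℕ} (G : Graph n) → Connected G → Regular G → ¬ Complete G → ActiveGraph G
mainTheorem4 G connected regular ¬complete v
  with x , y , vx , xy , y∉N[v] ← distance-two G regular connected ¬complete v
  = active-at-distance-two G regular vx xy y∉N[v]
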